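{- (Subformula property.) Every formula occurring in a normal $\mathsf{IEL}^{ - }$-deduction of $A$ from assumptions $\Gamma$ is a subformula of $A$ or of some formula in $\Gamma$.
   Context: Formulas: built from propositional atoms and $\bot$ by $\wedge,\vee,\rightarrow$ and a unary modality $\Box$. $\mathsf{IEL}^{ - }$ is the natural deduction system with the usual intuitionistic (NJ) introduction/elimination rules for $\wedge,\vee,\rightarrow$, ex falso, and the $\Box$-intro rule: from deductions of $\Box A_1,\dots,\Box A_n$ and a deduction of $B$ from assumptions $A_1,\dots,A_n,\Delta$, infer $\Box B$, discharging $A_1,\dots,A_n$. Deductions are identified with typed proof terms $x\mid \lambda x.t\mid ts\mid \langle t,s\rangle\mid \pi_i t\mid \mathsf{in}_i t\mid \mathsf{C}_{x,y}(t,t_1,t_2)$ ($\vee$-elim) $\mid \mathsf{E}(t)$ ($\bot$-elim) $\mid \mathsf{B}_{x_1,\dots,x_n}(t_1,\dots,t_n)\,\mathsf{in}\,s$ ($\Box$-intro, binding $x_i$ in $s$). A deduction is normal if its term contains no redex of any of the following (context-closed) reductions. Detours: $(\lambda x.t)s> t[x:=s]$; $\pi_i\langle t_1,t_2\rangle> t_i$; $\mathsf{C}_{x_1,x_2}(\mathsf{in}_i t,t_1,t_2)> t_i[x_i:=t]$; $\mathsf{B}_{\dots,x_i,\dots}(\dots,(\mathsf{B}_{\vec y}(\vec s)\,\mathsf{in}\,t_i),\dots)\,\mathsf{in}\,r > \mathsf{B}_{\dots,\vec y,\dots}(\dots,\vec s,\dots)\,\mathsf{in}\,r[x_i:=t_i]$;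 $\mathsf{B}_x t\,\mathsf{in}\,x> t$. Permutations: $\mathsf{C}_{x,y}(t,t_1,t_2)s>\mathsf{C}_{x,y}(t,t_1s,t_2s)$; $\pi_i\mathsf{C}_{x,y}(t,t_1,t_2)>\mathsf{C}_{x,y}(t,\pi_it_1,\pi_it_2)$; $\mathsf{C}_{u,v}(\mathsf{C}_{x,y}(t,t_1,t_2),s_1,s_2)>\mathsf{C}_{x,y}(t,\mathsf{C}_{u,v}(t_1,s_1,s_2),\mathsf{C}_{u,v}(t_2,s_1,s_2))$; $\mathsf{B}_{\vec x}(\dots,\mathsf{C}_{x,y}(t,s_1,s_2),\dots)\,\mathsf{in}\,s>\mathsf{C}_{x,y}(t,\mathsf{B}_{\vec x}(\dots,s_1,\dots)\,\mathsf{in}\,s,\mathsf{B}_{\vec x}(\dots,s_2,\dots)\,\mathsf{in}\,s)$; $\mathsf{E}(\mathsf{C}_{x,y}(t,t_1,t_2))>\mathsf{C}_{x,y}(t,\mathsf{E}(t_1),\mathsf{E}(t_2))$. $\bot$-conversions: $\mathsf{E}(t)s>\mathsf{E}(t)$; $\pi_i\mathsf{E}(t)>\mathsf{E}(t)$; $\mathsf{C}_{x,y}(\mathsf{E}(t),t_1,t_2)>\mathsf{E}(t)$; $\mathsf{E}(\mathsf{E}(t))>\mathsf{E}(t)$; $\mathsf{B}_{\vec x}(\dots,\mathsf{E}(t_i),\dots)\,\mathsf{in}\,s>\mathsf{E}(t_i)$. -}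

module Defs where

open import Data.Nat using (ℕ)
open import Data.List using (List; []; _∷_; _++_)
open import Data.List.Membership.Propositional using (_∈_)
open import Data.List.Relation.Unary.Any using (Any; here)
open import Data.Product using (Σ; _,_)
open import Relation.Nullary using (¬_)
open import Relation.Binary.PropositionalEquality using (refl)

infixr 30 _⇒_
infixr 32 _∨_
infixr 34 _∧_
infix 36 □_

data Fm : Set where
  atom : ℕ → Fm
  ⊥̇    : Fm
  _∧_  : Fm → Fm → Fm
  _∨_  : Fm → Fm → Fm
  _⇒_  : Fm → Fm → Fm
  □_   : Fm → Fm

Ctx : Set
Ctx = List Fm

data _⊑_ : Fm → Fm → Set where
  ⊑-refl : ∀ {A} → A ⊑ A
  ⊑-∧l   : ∀ {A B C} → A ⊑ B → A ⊑ (B ∧ C)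
  ⊑-∧r   : ∀ {A B C} → A ⊑ C → A ⊑ (B ∧ C)
  ⊑-∨l   : ∀ {A B C} → A ⊑ B → A ⊑ (B ∨ C)
  ⊑-∨r   : ∀ {A B C} → A ⊑ C → A ⊑ (B ∨ C)
  ⊑-⇒l   : ∀ {A B C} → A ⊑ B → A ⊑ (B ⇒ C)
  ⊑-⇒r   : ∀ {A B C} → A ⊑ C → A ⊑ (B ⇒ C)
  ⊑-□    : ∀ {A B} → A ⊑ B → A ⊑ (□ B)

-- IEL⁻ deductions as intrinsically typed proof terms (de Bruijn variables).
-- box ts s : from deductions ts of □A₁,…,□Aₙ and a deduction s of B from
-- A₁,…,Aₙ,Γ (the Aᵢ are discharged), infer □B.
infix 4 _⊢_
mutual
  data _⊢_ (Γ : Ctx) : Fm → Set where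
    var  : ∀ {A} → A ∈ Γ → Γ ⊢ A
    lam  : ∀ {A B} → (A ∷ Γ) ⊢ B → Γ ⊢ A ⇒ B
    app  : ∀ {A B} → Γ ⊢ A ⇒ B → Γ ⊢ A → Γ ⊢ B
    pair : ∀ {A B} → Γ ⊢ A → Γ ⊢ B → Γ ⊢ A ∧ B
    fst  : ∀ {A B} → Γ ⊢ A ∧ B → Γ ⊢ A
    snd  : ∀ {A B} → Γ ⊢ A ∧ B → Γ ⊢ B
    inl  : ∀ {A B} → Γ ⊢ A → Γ ⊢ A ∨ B
    inr  : ∀ {A B} → Γ ⊢ B → Γ ⊢ A ∨ B
    case : ∀ {A B C} → Γ ⊢ A ∨ B → (A ∷ Γ) ⊢ C → (B ∷ Γ) ⊢ C → Γ ⊢ C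
    efq  : ∀ {C} → Γ ⊢ ⊥̇ → Γ ⊢ C
    box  : ∀ {As B} → Boxes Γ As → (As ++ Γ) ⊢ B → Γ ⊢ □ B

  data Boxes (Γ : Ctx) : Ctx → Set where
    []  : Boxes Γ []
    _∷_ : ∀ {A As} → Γ ⊢ □ A → Boxes Γ As → Boxes Γ (A ∷ As)

data _∈B_ {Γ : Ctx} : ∀ {A As} → Γ ⊢ □ A → Boxes Γ As → Set where
  hereB  : ∀ {A As} {t : Γ ⊢ □ A} {ts : Boxes Γ As} → t ∈B (t ∷ ts)
  thereB : ∀ {A A' As} {t : Γ ⊢ □ A} {t' : Γ ⊢ □ A'} {ts : Boxes Γ As} →
           t ∈B ts → t ∈B (t' ∷ ts)

data IsBox {Γ : Ctx} : ∀ {A} → Γ ⊢ A → Set where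
  isBox : ∀ {As B} {ts : Boxes Γ As} {s : (As ++ Γ) ⊢ B} → IsBox (box ts s)

data IsCase {Γ : Ctx} : ∀ {A} → Γ ⊢ A → Set where
  isCase : ∀ {A B C} {t : Γ ⊢ A ∨ B} {u : (A ∷ Γ) ⊢ C} {v : (B ∷ Γ) ⊢ C} →
           IsCase (case t u v)

data IsEfq {Γ : Ctx} : ∀ {A} → Γ ⊢ A → Set where
  isEfq : ∀ {C} {t : Γ ⊢ ⊥̇} → IsEfq {A = C} (efq t)

data SomePrem {Γ : Ctx} (P : ∀ {A} → Γ ⊢ A → Set) : ∀ {As} → Boxes Γ As → Set where
  someHere  : ∀ {A As} {t : Γ ⊢ □ A} {ts : Boxes Γ As} → P t → SomePrem P (t ∷ ts)
  someThere : ∀ {A As} {t : Γ ⊢ □ A} {ts : Boxes Γ As} → SomePrem P ts → SomePrem P (t ∷ ts)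

-- Redexes: left-hand sides of detours, permutations and ⊥-conversions
data Redex {Γ : Ctx} : ∀ {A} → Γ ⊢ A → Set where
  r-β       : ∀ {A B} {t : (A ∷ Γ) ⊢ B} {s : Γ ⊢ A} → Redex (app (lam t) s)
  r-fst     : ∀ {A B} {t : Γ ⊢ A} {s : Γ ⊢ B} → Redex (fst (pair t s))
  r-snd     : ∀ {A B} {t : Γ ⊢ A} {s : Γ ⊢ B} → Redex (snd (pair t s))
  r-inl     : ∀ {A B C} {t : Γ ⊢ A} {u : (A ∷ Γ) ⊢ C} {v : (B ∷ Γ) ⊢ C} →
              Redex (case (inl t) u v)
  r-inr     : ∀ {A B C} {t : Γ ⊢ B} {u : (A ∷ Γ) ⊢ C} {v : (B ∷ Γ) ⊢ C} →
              Redex (case (inr t) u v)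
  r-boxbox  : ∀ {As B} {ts : Boxes Γ As} {s : (As ++ Γ) ⊢ B} →
              SomePrem IsBox ts → Redex (box ts s)
  r-boxid   : ∀ {A} {t : Γ ⊢ □ A} → Redex (box (t ∷ []) (var (here refl)))
  r-app-case  : ∀ {A B C D} {t : Γ ⊢ A ∨ B} {u : (A ∷ Γ) ⊢ C ⇒ D}
                {v : (B ∷ Γ) ⊢ C ⇒ D} {s : Γ ⊢ C} → Redex (app (case t u v) s)
  r-fst-case  : ∀ {A B C D} {t : Γ ⊢ A ∨ B} {u : (A ∷ Γ) ⊢ C ∧ D}
                {v : (B ∷ Γ) ⊢ C ∧ D} → Redex (fst (case t u v))
  r-snd-case  : ∀ {A B C D} {t : Γ ⊢ A ∨ B} {u : (A ∷ Γ) ⊢ C ∧ D}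
                {v : (B ∷ Γ) ⊢ C ∧ D} → Redex (snd (case t u v))
  r-case-case : ∀ {A B C D E} {t : Γ ⊢ A ∨ B} {u : (A ∷ Γ) ⊢ C ∨ D}
                {v : (B ∷ Γ) ⊢ C ∨ D} {w : (C ∷ Γ) ⊢ E} {z : (D ∷ Γ) ⊢ E} →
                Redex (case (case t u v) w z)
  r-box-case  : ∀ {As B} {ts : Boxes Γ As} {s : (As ++ Γ) ⊢ B} →
                SomePrem IsCase ts → Redex (box ts s)
  r-efq-case  : ∀ {A B C} {t : Γ ⊢ A ∨ B} {u : (A ∷ Γ) ⊢ ⊥̇}
                {v : (B ∷ Γ) ⊢ ⊥̇} → Redex {A = C} (efq (case t u v))
  r-app-efq   : ∀ {A B} {t : Γ ⊢ ⊥̇} {s : Γ ⊢ A} → Redex {A = B} (app (efq t) s)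
  r-fst-efq   : ∀ {A B} {t : Γ ⊢ ⊥̇} → Redex {A = A} (fst {B = B} (efq t))
  r-snd-efq   : ∀ {A B} {t : Γ ⊢ ⊥̇} → Redex {A = B} (snd {A = A} (efq t))
  r-case-efq  : ∀ {A B C} {t : Γ ⊢ ⊥̇} {u : (A ∷ Γ) ⊢ C} {v : (B ∷ Γ) ⊢ C} →
                Redex (case (efq t) u v)
  r-efq-efq   : ∀ {C} {t : Γ ⊢ ⊥̇} → Redex {A = C} (efq (efq t))
  r-box-efq   : ∀ {As B} {ts : Boxes Γ As} {s : (As ++ Γ) ⊢ B} →
                SomePrem IsEfq ts → Redex (box ts s)

infix 4 _≼_
data _≼_ {Δ : Ctx} {C : Fm} (u : Δ ⊢ C) : ∀ {Γ A} → Γ ⊢ A → Set where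
  ≼-refl  : u ≼ u
  ≼-lam   : ∀ {Γ A B} {t : (A ∷ Γ) ⊢ B} → u ≼ t → u ≼ lam t
  ≼-app₁  : ∀ {Γ A B} {t : Γ ⊢ A ⇒ B} {s : Γ ⊢ A} → u ≼ t → u ≼ app t s
  ≼-app₂  : ∀ {Γ A B} {t : Γ ⊢ A ⇒ B} {s : Γ ⊢ A} → u ≼ s → u ≼ app t s
  ≼-pair₁ : ∀ {Γ A B} {t : Γ ⊢ A} {s : Γ ⊢ B} → u ≼ t → u ≼ pair t s
  ≼-pair₂ : ∀ {Γ A B} {t : Γ ⊢ A} {s : Γ ⊢ B} → u ≼ s → u ≼ pair t s
  ≼-fst   : ∀ {Γ A B} {t : Γ ⊢ A ∧ B} → u ≼ t → u ≼ fst t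
  ≼-snd   : ∀ {Γ A B} {t : Γ ⊢ A ∧ B} → u ≼ t → u ≼ snd t
  ≼-inl   : ∀ {Γ A B} {t : Γ ⊢ A} → u ≼ t → u ≼ inl {B = B} t
  ≼-inr   : ∀ {Γ A B} {t : Γ ⊢ B} → u ≼ t → u ≼ inr {A = A} t
  ≼-case₀ : ∀ {Γ A B D} {t : Γ ⊢ A ∨ B} {v : (A ∷ Γ) ⊢ D} {w : (B ∷ Γ) ⊢ D} →
            u ≼ t → u ≼ case t v w
  ≼-case₁ : ∀ {Γ A B D} {t : Γ ⊢ A ∨ B} {v : (A ∷ Γ) ⊢ D} {w : (B ∷ Γ) ⊢ D} →
            u ≼ v → u ≼ case t v w
  ≼-case₂ : ∀ {Γ A B D} {t : Γ ⊢ A ∨ B} {v : (A ∷ Γ) ⊢ D} {w : (B ∷ Γ) ⊢ D} →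
            u ≼ w → u ≼ case t v w
  ≼-efq   : ∀ {Γ D} {t : Γ ⊢ ⊥̇} → u ≼ t → u ≼ efq {C = D} t
  ≼-boxP  : ∀ {Γ A As B} {t : Γ ⊢ □ A} {ts : Boxes Γ As} {s : (As ++ Γ) ⊢ B} →
            t ∈B ts → u ≼ t → u ≼ box ts s
  ≼-boxB  : ∀ {Γ As B} {ts : Boxes Γ As} {s : (As ++ Γ) ⊢ B} →
            u ≼ s → u ≼ box ts s

Normal : ∀ {Γ A} → Γ ⊢ A → Set
Normal t = ∀ {Δ C} (u : Δ ⊢ C) → u ≼ t → ¬ Redex u

Occurs : ∀ {Γ A} → Fm → Γ ⊢ A → Set
Occurs C t = Σ Ctx (λ Δ → Σ (Δ ⊢ C) (λ u → u ≼ t))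

{-# OPTIONS --safe #-}
module Submission where

-- In a normal deduction neither the major premise of an elimination nor a
-- premise of a □-introduction can be an introduction (detour), a ∨-elimination
-- (permutation) or an ex falso (⊥-conversion). So it is neutral: a chain of
-- eliminations headed by a hypothesis, whose conclusion is a subformula of that
-- hypothesis. This bounds those premises and the formulas discharged by
-- ∨-elimination and □-introduction; every other formula of the deduction is a
-- subformula of the conclusion of an enclosing introduction.

open import Defs
open import Data.List using (_∷_; _++_)
open import Data.List.Membership.Propositional using (_∈_)
open import Data.List.Relation.Unary.All using (All; []; _∷_)
open import Data.List.Relation.Unary.Any using (Any; here; there)
import Data.List.Relation.Unary.Any as Any
open import Data.Product using (_,_)
open import Data.Sum using (_⊎_; inj₁; inj₂; [_,_]′)
import Data.Sum as Sum
open import Data.Empty using (⊥-elim)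
open import Function using (id; _∘_)
open import Relation.Binary.PropositionalEquality using (refl)

⊑-trans : ∀ {A B C} → A ⊑ B → B ⊑ C → A ⊑ C
⊑-trans p ⊑-refl   = p
⊑-trans p (⊑-∧l q) = ⊑-∧l (⊑-trans p q)
⊑-trans p (⊑-∧r q) = ⊑-∧r (⊑-trans p q)
⊑-trans p (⊑-∨l q) = ⊑-∨l (⊑-trans p q)
⊑-trans p (⊑-∨r q) = ⊑-∨r (⊑-trans p q)
⊑-trans p (⊑-⇒l q) = ⊑-⇒l (⊑-trans p q)
⊑-trans p (⊑-⇒r q) = ⊑-⇒r (⊑-trans p q)
⊑-trans p (⊑-□ q)  = ⊑-□ (⊑-trans p q)

⊑-hyp-trans : ∀ {Γ B C} → C ⊑ B → Any (B ⊑_) Γ → Any (C ⊑_) Γ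
⊑-hyp-trans p = Any.map (⊑-trans p)

⊑⊎hyp⇒hyp : ∀ {Γ B C} → Any (B ⊑_) Γ → C ⊑ B ⊎ Any (C ⊑_) Γ → Any (C ⊑_) Γ
⊑⊎hyp⇒hyp h = [ (λ q → ⊑-hyp-trans q h) , id ]′

hyp-discharge : ∀ {Γ Δ C} → All (λ B → Any (B ⊑_) Γ) Δ →
                Any (C ⊑_) (Δ ++ Γ) → Any (C ⊑_) Γ
hyp-discharge []       q         = q
hyp-discharge (h ∷ hs) (here q)  = ⊑-hyp-trans q h
hyp-discharge (h ∷ hs) (there q) = hyp-discharge hs q

tabulateB : ∀ {Γ As} {ts : Boxes Γ As} {P : Fm → Set} →
            (∀ {A} {t : Γ ⊢ □ A} → t ∈B ts → P A) → All P As
tabulateB {ts = []}     f = []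
tabulateB {ts = t ∷ ts} f = f hereB ∷ tabulateB (f ∘ thereB)

normal-sub : ∀ {Γ Δ A B} {t : Γ ⊢ A} {u : Δ ⊢ B} →
             (∀ {Θ C} {w : Θ ⊢ C} → w ≼ u → w ≼ t) → Normal t → Normal u
normal-sub sub n w p = n w (sub p)

data Neutral {Γ : Ctx} : ∀ {A} → Γ ⊢ A → Set where
  var : ∀ {A} {x : A ∈ Γ} → Neutral (var x)
  app : ∀ {A B} {t : Γ ⊢ A ⇒ B} {s : Γ ⊢ A} → Neutral (app t s)
  fst : ∀ {A B} {t : Γ ⊢ A ∧ B} → Neutral (fst t)
  snd : ∀ {A B} {t : Γ ⊢ A ∧ B} → Neutral (snd t)

SomePrem-∈B : ∀ {Γ} {P : ∀ {A} → Γ ⊢ A → Set} {A As} {t : Γ ⊢ □ A} {ts : Boxes Γ As} →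
              P t → t ∈B ts → SomePrem P ts
SomePrem-∈B p hereB      = someHere p
SomePrem-∈B p (thereB m) = someThere (SomePrem-∈B p m)

app-major-neutral : ∀ {Γ A B} (t : Γ ⊢ A ⇒ B) {s : Γ ⊢ A} → Normal (app t s) → Neutral t
app-major-neutral (var x)      n = var
app-major-neutral (lam t)      n = ⊥-elim (n _ ≼-refl r-β)
app-major-neutral (app t s)    n = app
app-major-neutral (fst t)      n = fst
app-major-neutral (snd t)      n = snd
app-major-neutral (case t u v) n = ⊥-elim (n _ ≼-refl r-app-case)
app-major-neutral (efq t)      n = ⊥-elim (n _ ≼-refl r-app-efq)

fst-major-neutral : ∀ {Γ A B} (t : Γ ⊢ A ∧ B) → Normal (fst t) → Neutral t
fst-major-neutral (var x)      n = var
fst-major-neutral (app t s)    n = app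
fst-major-neutral (pair t s)   n = ⊥-elim (n _ ≼-refl r-fst)
fst-major-neutral (fst t)      n = fst
fst-major-neutral (snd t)      n = snd
fst-major-neutral (case t u v) n = ⊥-elim (n _ ≼-refl r-fst-case)
fst-major-neutral (efq t)      n = ⊥-elim (n _ ≼-refl r-fst-efq)

snd-major-neutral : ∀ {Γ A B} (t : Γ ⊢ A ∧ B) → Normal (snd t) → Neutral t
snd-major-neutral (var x)      n = var
snd-major-neutral (app t s)    n = app
snd-major-neutral (pair t s)   n = ⊥-elim (n _ ≼-refl r-snd)
snd-major-neutral (fst t)      n = fst
snd-major-neutral (snd t)      n = snd
snd-major-neutral (case t u v) n = ⊥-elim (n _ ≼-refl r-snd-case)
snd-major-neutral (efq t)      n = ⊥-elim (n _ ≼-refl r-snd-efq)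

case-major-neutral : ∀ {Γ A B C} (t : Γ ⊢ A ∨ B) {u : (A ∷ Γ) ⊢ C} {v : (B ∷ Γ) ⊢ C} →
                     Normal (case t u v) → Neutral t
case-major-neutral (var x)      n = var
case-major-neutral (app t s)    n = app
case-major-neutral (fst t)      n = fst
case-major-neutral (snd t)      n = snd
case-major-neutral (inl t)      n = ⊥-elim (n _ ≼-refl r-inl)
case-major-neutral (inr t)      n = ⊥-elim (n _ ≼-refl r-inr)
case-major-neutral (case t u v) n = ⊥-elim (n _ ≼-refl r-case-case)
case-major-neutral (efq t)      n = ⊥-elim (n _ ≼-refl r-case-efq)

efq-major-neutral : ∀ {Γ C} (t : Γ ⊢ ⊥̇) → Normal (efq {C = C} t) → Neutral t
efq-major-neutral (var x)      n = var
efq-major-neutral (app t s)    n = app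
efq-major-neutral (fst t)      n = fst
efq-major-neutral (snd t)      n = snd
efq-major-neutral (case t u v) n = ⊥-elim (n _ ≼-refl r-efq-case)
efq-major-neutral (efq t)      n = ⊥-elim (n _ ≼-refl r-efq-efq)

box-premise-neutral : ∀ {Γ A As B} (t : Γ ⊢ □ A) {ts : Boxes Γ As} {s : (As ++ Γ) ⊢ B} →
                      Normal (box ts s) → t ∈B ts → Neutral t
box-premise-neutral (var x)      n m = var
box-premise-neutral (app t s)    n m = app
box-premise-neutral (fst t)      n m = fst
box-premise-neutral (snd t)      n m = snd
box-premise-neutral (case t u v) n m = ⊥-elim (n _ ≼-refl (r-box-case (SomePrem-∈B isCase m)))
box-premise-neutral (efq t)      n m = ⊥-elim (n _ ≼-refl (r-box-efq (SomePrem-∈B isEfq m)))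
box-premise-neutral (box us s)   n m = ⊥-elim (n _ ≼-refl (r-boxbox (SomePrem-∈B isBox m)))

mutual
  neutral-⊑-hyp : ∀ {Γ A} {t : Γ ⊢ A} → Normal t → Neutral t → Any (A ⊑_) Γ
  neutral-⊑-hyp {t = var x} n var = Any.map (λ { refl → ⊑-refl }) x
  neutral-⊑-hyp {t = app t s} n app = ⊑-hyp-trans (⊑-⇒r ⊑-refl) (app-major-⊑-hyp t n)
  neutral-⊑-hyp {t = fst t}   n fst = ⊑-hyp-trans (⊑-∧l ⊑-refl) (fst-major-⊑-hyp t n)
  neutral-⊑-hyp {t = snd t}   n snd = ⊑-hyp-trans (⊑-∧r ⊑-refl) (snd-major-⊑-hyp t n)

  app-major-⊑-hyp : ∀ {Γ A B} (t : Γ ⊢ A ⇒ B) {s : Γ ⊢ A} → Normal (app t s) →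
                    Any ((A ⇒ B) ⊑_) Γ
  app-major-⊑-hyp t n = neutral-⊑-hyp (normal-sub ≼-app₁ n) (app-major-neutral t n)

  fst-major-⊑-hyp : ∀ {Γ A B} (t : Γ ⊢ A ∧ B) → Normal (fst t) → Any ((A ∧ B) ⊑_) Γ
  fst-major-⊑-hyp t n = neutral-⊑-hyp (normal-sub ≼-fst n) (fst-major-neutral t n)

  snd-major-⊑-hyp : ∀ {Γ A B} (t : Γ ⊢ A ∧ B) → Normal (snd t) → Any ((A ∧ B) ⊑_) Γ
  snd-major-⊑-hyp t n = neutral-⊑-hyp (normal-sub ≼-snd n) (snd-major-neutral t n)

  case-major-⊑-hyp : ∀ {Γ A B C} (t : Γ ⊢ A ∨ B) {u : (A ∷ Γ) ⊢ C} {v : (B ∷ Γ) ⊢ C} →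
                     Normal (case t u v) → Any ((A ∨ B) ⊑_) Γ
  case-major-⊑-hyp t n = neutral-⊑-hyp (normal-sub ≼-case₀ n) (case-major-neutral t n)

  efq-major-⊑-hyp : ∀ {Γ C} (t : Γ ⊢ ⊥̇) → Normal (efq {C = C} t) → Any (⊥̇ ⊑_) Γ
  efq-major-⊑-hyp t n = neutral-⊑-hyp (normal-sub ≼-efq n) (efq-major-neutral t n)

box-premise-⊑-hyp : ∀ {Γ A As B} {t : Γ ⊢ □ A} {ts : Boxes Γ As} {s : (As ++ Γ) ⊢ B} →
                    Normal (box ts s) → t ∈B ts → Any (□ A ⊑_) Γ
box-premise-⊑-hyp {t = t} n m =
  neutral-⊑-hyp (normal-sub (≼-boxP m) n) (box-premise-neutral t n m)

occurs-⊑ : ∀ {Γ A Δ C} {t : Γ ⊢ A} {u : Δ ⊢ C} → Normal t → u ≼ t →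
           C ⊑ A ⊎ Any (C ⊑_) Γ
occurs-⊑ n ≼-refl = inj₁ ⊑-refl
occurs-⊑ n (≼-lam p) with occurs-⊑ (normal-sub ≼-lam n) p
... | inj₁ q         = inj₁ (⊑-⇒r q)
... | inj₂ (here q)  = inj₁ (⊑-⇒l q)
... | inj₂ (there q) = inj₂ q
occurs-⊑ n (≼-pair₁ p) = Sum.map₁ ⊑-∧l (occurs-⊑ (normal-sub ≼-pair₁ n) p)
occurs-⊑ n (≼-pair₂ p) = Sum.map₁ ⊑-∧r (occurs-⊑ (normal-sub ≼-pair₂ n) p)
occurs-⊑ n (≼-inl p)   = Sum.map₁ ⊑-∨l (occurs-⊑ (normal-sub ≼-inl n) p)
occurs-⊑ n (≼-inr p)   = Sum.map₁ ⊑-∨r (occurs-⊑ (normal-sub ≼-inr n) p)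
occurs-⊑ {t = app t s} n (≼-app₁ p) =
  inj₂ (⊑⊎hyp⇒hyp (app-major-⊑-hyp t n) (occurs-⊑ (normal-sub ≼-app₁ n) p))
occurs-⊑ {t = app t s} n (≼-app₂ p) =
  inj₂ (⊑⊎hyp⇒hyp (⊑-hyp-trans (⊑-⇒l ⊑-refl) (app-major-⊑-hyp t n))
                  (occurs-⊑ (normal-sub ≼-app₂ n) p))
occurs-⊑ {t = fst t} n (≼-fst p) =
  inj₂ (⊑⊎hyp⇒hyp (fst-major-⊑-hyp t n) (occurs-⊑ (normal-sub ≼-fst n) p))
occurs-⊑ {t = snd t} n (≼-snd p) =
  inj₂ (⊑⊎hyp⇒hyp (snd-major-⊑-hyp t n) (occurs-⊑ (normal-sub ≼-snd n) p))
occurs-⊑ {t = case t u v} n (≼-case₀ p) =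
  inj₂ (⊑⊎hyp⇒hyp (case-major-⊑-hyp t n) (occurs-⊑ (normal-sub ≼-case₀ n) p))
occurs-⊑ {t = case t u v} n (≼-case₁ p) =
  Sum.map₂ (hyp-discharge (⊑-hyp-trans (⊑-∨l ⊑-refl) (case-major-⊑-hyp t n) ∷ []))
           (occurs-⊑ (normal-sub ≼-case₁ n) p)
occurs-⊑ {t = case t u v} n (≼-case₂ p) =
  Sum.map₂ (hyp-discharge (⊑-hyp-trans (⊑-∨r ⊑-refl) (case-major-⊑-hyp t n) ∷ []))
           (occurs-⊑ (normal-sub ≼-case₂ n) p)
occurs-⊑ {t = efq t} n (≼-efq p) =
  inj₂ (⊑⊎hyp⇒hyp (efq-major-⊑-hyp t n) (occurs-⊑ (normal-sub ≼-efq n) p))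
occurs-⊑ n (≼-boxP m p) =
  inj₂ (⊑⊎hyp⇒hyp (box-premise-⊑-hyp n m) (occurs-⊑ (normal-sub (≼-boxP m) n) p))
occurs-⊑ n (≼-boxB p) =
  Sum.map ⊑-□ (hyp-discharge (tabulateB (⊑-hyp-trans (⊑-□ ⊑-refl) ∘ box-premise-⊑-hyp n)))
          (occurs-⊑ (normal-sub ≼-boxB n) p)

corollary27 : (Γ : Ctx) (A : Fm) (t : Γ ⊢ A) → Normal t →
    (C : Fm) → Occurs C t → C ⊑ A ⊎ Any (C ⊑_) Γ
corollary27 Γ A t n C (Δ , u , p) = occurs-⊑ n p
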